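{- Let $q$ be a power of an odd prime with $q\equiv 3\pmod 4$, let $r$ be a positive integer, $u\in\mathbb{F}_q$, and $F_{r,u}(x)=x^r\big(1+u\eta(x)\big)$. For any $a\in\mathbb{F}_q^*$ and $b\in\mathbb{F}_q$, $\delta_{F_{r,u}}(a,b)=\delta_{F_{r,u}}(1,\frac{b}{a^r})$ if $\eta(a)=1$ and $\delta_{F_{r,u}}(a,b)=\delta_{F_{r,u}}(1,\frac{b}{(-1)^{r+1}a^r})$ if $\eta(a)=-1$; and $\beta_{F_{r,u}}(a,b)=\beta_{F_{r,u}}(1,\frac{b}{a^r})$ if $\eta(a)=1$ and $\beta_{F_{r,u}}(a,b)=\beta_{F_{r,u}}(1,\frac{b}{(-1)^{r}a^r})$ if $\eta(a)=-1$. In particular, $\delta_{F_{r,u}}=\max_{b\in\mathbb{F}_q}\delta_{F_{r,u}}(1,b)$ and $\beta_{F_{r,u}}=\max_{b\in\mathbb{F}_q^*}\beta_{F_{r,u}}(1,b)$.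
   Context: $\eta$ is the quadratic character of $\mathbb{F}_q$ ($\eta(0)=0$, $\eta=1$ on nonzero squares, $-1$ on non-squares). For $f$ on $\mathbb{F}_q$: $\delta_f(a,b)=\#\{x: f(x+a)-f(x)=b\}$, $\delta_f=\max_{a\ne0,b}\delta_f(a,b)$; $\beta_f(a,b)$ is the number of $(x,y)\in\mathbb{F}_q^2$ with $f(x)-f(y)=b$ and $f(x+a)-f(y+a)=b$, and $\beta_f=\max_{a,b\in\mathbb{F}_q^*}\beta_f(a,b)$. -}

module Defs where

open import Level using (0ℓ)
open import Data.Nat as ℕ using (ℕ; zero; suc; _⊔_)
open import Data.Integer as ℤ using (ℤ; +_; -[1+_])
open import Data.Fin using (Fin)
open import Data.List using (List; map; filter; length; foldr; allFin; cartesianProduct; concatMap)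
open import Data.List.Relation.Unary.Any using (any?)
open import Data.Product using (_×_; _,_; proj₁; proj₂)
open import Relation.Nullary using (Dec; yes; no; ¬_)
open import Relation.Nullary.Decidable using (¬?; _×-dec_)
open import Relation.Binary.PropositionalEquality using (_≡_; _≢_)
open import Relation.Binary.Definitions using (DecidableEquality)
open import Algebra.Structures using (IsCommutativeRing)
open import Function.Bundles using (Inverse; _↔_)

-- A finite field, with propositional equality, a (total) inverse map that
-- is a genuine inverse on nonzero elements, and an explicit enumeration
-- Fin size ↔ Carrier (so size = q = #F).
record FiniteField : Set₁ where
  infixl 7 _*_
  infixl 6 _+_
  field
    Carrier : Set
    _≟_     : DecidableEquality Carrier
    _+_ _*_ : Carrier → Carrier → Carrier
    -_      : Carrier → Carrier
    0# 1#   : Carrier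
    isCommutativeRing : IsCommutativeRing _≡_ _+_ _*_ -_ 0# 1#
    0≢1     : 0# ≢ 1#
    _⁻¹     : Carrier → Carrier
    inverseʳ : ∀ x → x ≢ 0# → x * (x ⁻¹) ≡ 1#
    size    : ℕ
    enum    : Fin size ↔ Carrier

module FF (K : FiniteField) where
  open FiniteField K public

  _-_ : Carrier → Carrier → Carrier
  x - y = x + (- y)

  _/_ : Carrier → Carrier → Carrier
  x / y = x * (y ⁻¹)

  _^_ : Carrier → ℕ → Carrier
  x ^ zero  = 1#
  x ^ suc n = x * (x ^ n)

  elems : List Carrier
  elems = map (Inverse.to enum) (allFin size)

  ιℕ : ℕ → Carrier
  ιℕ zero    = 0#
  ιℕ (suc n) = 1# + ιℕ n

  ι : ℤ → Carrier
  ι (+ n)    = ιℕ n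
  ι -[1+ n ] = - ιℕ (suc n)

  IsSquare : Carrier → Set
  IsSquare x = Data.List.Relation.Unary.Any.Any (λ y → y * y ≡ x) elems

  η : Carrier → ℤ
  η x with x ≟ 0#
  ... | yes _ = + 0
  ... | no  _ with any? (λ y → (y * y) ≟ x) elems
  ... | yes _ = + 1
  ... | no  _ = -[1+ 0 ]

  δ : (Carrier → Carrier) → Carrier → Carrier → ℕ
  δ f a b = length (filter (λ x → (f (x + a) - f x) ≟ b) elems)

  β : (Carrier → Carrier) → Carrier → Carrier → ℕ
  β f a b = length (filter (λ p → ((f (proj₁ p) - f (proj₂ p)) ≟ b)
                                ×-dec ((f (proj₁ p + a) - f (proj₂ p + a)) ≟ b))
                           (cartesianProduct elems elems))

  maxℕ : List ℕ → ℕ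
  maxℕ = foldr _⊔_ 0

  nonzero : List Carrier
  nonzero = filter (λ x → ¬? (x ≟ 0#)) elems

  δmax : (Carrier → Carrier) → ℕ
  δmax f = maxℕ (concatMap (λ a → map (δ f a) elems) nonzero)

  βmax : (Carrier → Carrier) → ℕ
  βmax f = maxℕ (concatMap (λ a → map (β f a) nonzero) nonzero)

  Fru : ℕ → Carrier → Carrier → Carrier
  Fru r u x = (x ^ r) * (1# + u * ι (η x))

-- Let η(a) = 1. Since η is multiplicative, F(a z) = a^r F(z), so the substitution x = a w
-- turns both equations defining δ(a, b) and β(a, b) into those for a = 1 with b rescaled
-- by a^r. Let η(a) = -1. As q ≡ 3 (mod 4), -1 is a non-square, so -a is a square and
-- F(-a z) = (-a)^r F(z); the substitution x = -a (w + 1) turns x + a into -a w, which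
-- flips the sign of the δ-equation and swaps the two β-equations.
-- The facts about η come from counting: in odd characteristic negation pairs off the
-- nonzero elements, so half of them are squares, which forces a product of two
-- non-squares to be a square; and if -1 were a square, negation would also pair off the
-- nonzero squares, giving q ≡ 1 (mod 4).

module Submission where

open import Defs
open import Level using (0ℓ)
open import Algebra.Bundles using (CommutativeRing)
open import Data.Empty using (⊥-elim)
import Data.Fin as Fin
import Data.Fin.Properties as Finₚ
open import Data.Integer as ℤ using (+_; -[1+_])
import Data.Integer.Properties as ℤₚ
open import Data.List using (List; []; _∷_; length; filter; map; allFin; concatMap; foldr; cartesianProduct)
import Data.List.Properties as Listₚ
open import Data.List.Membership.Propositional using (_∈_; find)
open import Data.List.Membership.Propositional.Properties
  using (∈-filter⁺; ∈-filter⁻; ∈-map⁺; ∈-map⁻; ∈-concatMap⁺; ∈-concatMap⁻; ∈-allFin; ∈-cartesianProduct⁺)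
open import Data.List.Relation.Unary.Any as Any using (here; there; _─_; any?)
import Data.List.Relation.Unary.All as All
open import Data.List.Relation.Unary.AllPairs using (_∷_)
open import Data.List.Relation.Unary.Unique.Propositional using (Unique)
import Data.List.Relation.Unary.Unique.Propositional.Properties as Uniqueₚ
open import Data.Nat as ℕ using (ℕ; zero; suc; _%_; _≤_; _<_; _<?_; _⊔_; z≤n; s≤s)
import Data.Nat.Properties as ℕₚ
import Data.Nat.DivMod as DivMod
open import Data.Nat.Divisibility using (divides)
open import Data.Nat.Primality using (Prime)
open import Data.Nat.Tactic.RingSolver using (solve-∀)
open import Data.Product using (Σ; ∃-syntax; ∃₂; _×_; _,_; proj₁; proj₂)
open import Data.Product.Function.NonDependent.Propositional using (_×-↔_)
open import Data.Sum using (_⊎_; inj₁; inj₂)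
open import Data.Unit using (⊤; tt)
open import Function.Base using (_∘_; case_of_)
open import Function.Bundles using (Inverse; _↔_; mk↔ₛ′)
open import Relation.Binary.Definitions using (DecidableEquality)
open import Relation.Binary.PropositionalEquality
open import Relation.Nullary using (Dec; yes; no; ¬_)
open import Relation.Nullary.Decidable using (¬?)
open import Relation.Unary using (Pred; Decidable)
open import Relation.Unary.Properties using (_∩?_; ∁?)

private
  ∈-─ : ∀ {A : Set} {y z : A} (ys : List A) (y∈ys : y ∈ ys) → z ∈ ys → z ≢ y → z ∈ (ys ─ y∈ys)
  ∈-─ (_ ∷ _)  (here refl) (here refl) z≢y = ⊥-elim (z≢y refl)
  ∈-─ (_ ∷ _)  (here refl) (there z∈)  _   = z∈
  ∈-─ (_ ∷ _)  (there _)   (here refl) _   = here refl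
  ∈-─ (_ ∷ ys) (there y∈)  (there z∈)  z≢y = there (∈-─ ys y∈ z∈ z≢y)

injective⇒length≤ : ∀ {A B : Set} {xs : List A} (ys : List B) (f : A → B) → Unique xs →
  (∀ {x y} → x ∈ xs → y ∈ xs → f x ≡ f y → x ≡ y) → (∀ {x} → x ∈ xs → f x ∈ ys) →
  length xs ≤ length ys
injective⇒length≤ {xs = []}     ys f _              _   _    = z≤n
injective⇒length≤ {xs = x ∷ xs} ys f (x∉xs ∷ xs-unique) inj into =
  subst (suc (length xs) ≤_) (sym (Listₚ.length-removeAt′ ys (Any.index fx∈ys)))
    (s≤s (injective⇒length≤ (ys ─ fx∈ys) f xs-unique
      (λ p q → inj (there p) (there q))
      (λ z∈xs → ∈-─ ys fx∈ys (into (there z∈xs))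
                  (λ fz≡fx → All.lookup x∉xs z∈xs (sym (inj (there z∈xs) (here refl) fz≡fx))))))
  where
  fx∈ys : f x ∈ ys
  fx∈ys = into (here refl)

length-filter-∩ : ∀ {A : Set} {P Q : Pred A 0ℓ} (P? : Decidable P) (Q? : Decidable Q) (xs : List A) →
  length (filter P? xs) ≡ length (filter (P? ∩? Q?) xs) ℕ.+ length (filter (P? ∩? ∁? Q?) xs)
length-filter-∩ P? Q? [] = refl
length-filter-∩ P? Q? (x ∷ xs) with P? x | Q? x
... | yes _ | yes _ = cong suc (length-filter-∩ P? Q? xs)
... | yes _ | no _  = trans (cong suc (length-filter-∩ P? Q? xs)) (sym (ℕₚ.+-suc _ _))
... | no _  | _     = length-filter-∩ P? Q? xs

module Counting {A : Set} (U : List A) (U-unique : Unique U) (U-complete : ∀ x → x ∈ U) where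

  count : {P : Pred A 0ℓ} → Decidable P → ℕ
  count P? = length (filter P? U)

  private
    satisfied : ∀ {P : Pred A 0ℓ} (P? : Decidable P) {x} → x ∈ filter P? U → P x
    satisfied P? x∈ = proj₂ (∈-filter⁻ P? {xs = U} x∈)

  count-≤ : {P Q : Pred A 0ℓ} (P? : Decidable P) (Q? : Decidable Q) (f : A → A) →
    (∀ {x} → P x → Q (f x)) → (∀ {x y} → P x → P y → f x ≡ f y → x ≡ y) →
    count P? ≤ count Q?
  count-≤ P? Q? f PQ inj = injective⇒length≤ (filter Q? U) f (Uniqueₚ.filter⁺ P? U-unique)
    (λ x∈ y∈ → inj (satisfied P? x∈) (satisfied P? y∈))
    (λ {x} x∈ → ∈-filter⁺ Q? (U-complete (f x)) (PQ (satisfied P? x∈)))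

  count-< : {P Q : Pred A 0ℓ} (P? : Decidable P) (Q? : Decidable Q) →
    (∀ {x} → P x → Q x) → ∀ m → Q m → ¬ P m → count P? < count Q?
  count-< {P} P? Q? P⊆Q m Qm ¬Pm = injective⇒length≤ (filter Q? U) (λ x → x)
    (All.tabulate (λ x∈ m≡x → ¬Pm (subst P (sym m≡x) (satisfied P? x∈))) ∷ Uniqueₚ.filter⁺ P? U-unique)
    (λ _ _ x≡y → x≡y) into
    where
    into : ∀ {x} → x ∈ m ∷ filter P? U → x ∈ filter Q? U
    into (here refl) = ∈-filter⁺ Q? (U-complete m) Qm
    into (there x∈)  = ∈-filter⁺ Q? (U-complete _) (P⊆Q (satisfied P? x∈))

  count-↔ : {P Q : Pred A 0ℓ} (P? : Decidable P) (Q? : Decidable Q) (e : A ↔ A) →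
    let open Inverse e in (∀ {x} → P (to x) → Q x) → (∀ {x} → Q x → P (to x)) →
    count P? ≡ count Q?
  count-↔ {P} P? Q? e PQ QP = ℕₚ.≤-antisym
    (count-≤ P? Q? from (λ {x} Px → PQ (subst P (sym (strictlyInverseˡ x)) Px)) (λ _ _ → injective from to strictlyInverseˡ))
    (count-≤ Q? P? to QP (λ _ _ → injective to from strictlyInverseʳ))
    where
    open Inverse e
    injective : (f g : A → A) → (∀ x → g (f x) ≡ x) → ∀ {x y} → f x ≡ f y → x ≡ y
    injective f g gf {x} {y} fx≡fy = trans (sym (gf x)) (trans (cong g fx≡fy) (gf y))

  count-∩ : {P Q : Pred A 0ℓ} (P? : Decidable P) (Q? : Decidable Q) →
    count P? ≡ count (P? ∩? Q?) ℕ.+ count (P? ∩? ∁? Q?)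
  count-∩ P? Q? = length-filter-∩ P? Q? U

  count-⊤ : count {λ _ → ⊤} (λ _ → yes tt) ≡ length U
  count-⊤ = cong length (Listₚ.filter-all (λ _ → yes tt) (All.universal (λ _ → tt) U))

  count-∁ : {P : Pred A 0ℓ} (P? : Decidable P) → length U ≡ count P? ℕ.+ count (∁? P?)
  count-∁ P? = begin
    length U                                                  ≡⟨ count-⊤ ⟨
    count {λ _ → ⊤} (λ _ → yes tt)                            ≡⟨ count-∩ (λ _ → yes tt) P? ⟩
    count ((λ _ → yes tt) ∩? P?) ℕ.+ count ((λ _ → yes tt) ∩? ∁? P?)
      ≡⟨ cong₂ ℕ._+_ (cong length (Listₚ.filter-≐ _ P? (proj₂ , (tt ,_)) U))
                   (cong length (Listₚ.filter-≐ _ (∁? P?) (proj₂ , (tt ,_)) U)) ⟩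
    count P? ℕ.+ count (∁? P?)                                  ∎
    where open ≡-Reasoning

  count-singleton : (_≟_ : DecidableEquality A) (z : A) → count (_≟ z) ≡ 1
  count-singleton _≟_ z = ℕₚ.≤-antisym
    (injective⇒length≤ (z ∷ []) (λ x → x) (Uniqueₚ.filter⁺ (_≟ z) U-unique) (λ _ _ x≡y → x≡y)
      (λ x∈ → here (satisfied (_≟ z) x∈)))
    (Listₚ.filter-some (_≟ z) (Any.map (λ z≡x → sym z≡x) (U-complete z)))

  count-involution : {D : Pred A 0ℓ} (D? : Decidable D) (key : A → ℕ) →
    (∀ {x y} → key x ≡ key y → x ≡ y) → (σ : A → A) → (∀ x → σ (σ x) ≡ x) →
    (∀ {x} → D x → D (σ x)) → (∀ {x} → D x → σ x ≢ x) →
    let L? = λ x → key x <? key (σ x) in count D? ≡ count (D? ∩? L?) ℕ.+ count (D? ∩? L?)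
  count-involution {D} D? key key-injective σ σσ≡id D-σ σ-fixpointFree =
    trans (count-∩ D? L?) (cong (count (D? ∩? L?) ℕ.+_) (sym below≡above))
    where
    L? : Decidable (λ x → key x < key (σ x))
    L? x = key x <? key (σ x)
    below≡above : count (D? ∩? L?) ≡ count (D? ∩? ∁? L?)
    below≡above = count-↔ (D? ∩? L?) (D? ∩? ∁? L?) (mk↔ₛ′ σ σ σσ≡id σσ≡id)
      (λ {x} (Dσx , σx<σσx) → subst D (σσ≡id x) (D-σ Dσx) ,
         λ x<σx → ℕₚ.<-asym x<σx (subst (λ t → key (σ x) < key t) (σσ≡id x) σx<σσx))
      (λ {x} (Dx , x≮σx) → D-σ Dx ,
         subst (λ t → key (σ x) < key t) (sym (σσ≡id x))
           (ℕₚ.≤∧≢⇒< (ℕₚ.≮⇒≥ x≮σx) (λ σx≡x → σ-fixpointFree Dx (key-injective σx≡x))))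

≤-foldr-⊔ : ∀ {n} (ns : List ℕ) → n ∈ ns → n ≤ foldr _⊔_ 0 ns
≤-foldr-⊔ (n ∷ ns) (here refl) = ℕₚ.m≤m⊔n n (foldr _⊔_ 0 ns)
≤-foldr-⊔ (n ∷ ns) (there m∈)  = ℕₚ.≤-trans (≤-foldr-⊔ ns m∈) (ℕₚ.m≤n⊔m n (foldr _⊔_ 0 ns))

foldr-⊔-≤ : ∀ {m} (ns : List ℕ) → (∀ {n} → n ∈ ns → n ≤ m) → foldr _⊔_ 0 ns ≤ m
foldr-⊔-≤ []       _     = z≤n
foldr-⊔-≤ (n ∷ ns) ns≤m = ℕₚ.⊔-lub (ns≤m (here refl)) (foldr-⊔-≤ ns (λ n∈ → ns≤m (there n∈)))

foldr-⊔-concatMap-row : ∀ {A B : Set} (L : A → B → ℕ) {xs : List A} {ys : List B} {x₀ : A} →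
  x₀ ∈ xs → (∀ {x y} → x ∈ xs → y ∈ ys → ∃[ y′ ] y′ ∈ ys × L x y ≡ L x₀ y′) →
  foldr _⊔_ 0 (concatMap (λ x → map (L x) ys) xs) ≡ foldr _⊔_ 0 (map (L x₀) ys)
foldr-⊔-concatMap-row L {xs} {ys} {x₀} x₀∈xs reduce =
  ℕₚ.≤-antisym (foldr-⊔-≤ table table≤row₀) (foldr-⊔-≤ row₀ row₀≤table)
  where
  table row₀ : List ℕ
  table = concatMap (λ x → map (L x) ys) xs
  row₀  = map (L x₀) ys

  table≤row₀ : ∀ {n} → n ∈ table → n ≤ foldr _⊔_ 0 row₀
  table≤row₀ n∈table with find (∈-concatMap⁻ (λ x → map (L x) ys) {xs = xs} n∈table)
  ... | x , x∈xs , n∈row with ∈-map⁻ (L x) n∈row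
  ... | y , y∈ys , refl with reduce x∈xs y∈ys
  ... | y′ , y′∈ys , Lxy≡Lx₀y′ = subst (_≤ foldr _⊔_ 0 row₀) (sym Lxy≡Lx₀y′) (≤-foldr-⊔ row₀ (∈-map⁺ (L x₀) y′∈ys))

  row₀≤table : ∀ {n} → n ∈ row₀ → n ≤ foldr _⊔_ 0 table
  row₀≤table n∈row₀ = ≤-foldr-⊔ table (∈-concatMap⁺ (λ x → map (L x) ys) (Any.map (λ { refl → n∈row₀ }) x₀∈xs))

module Field (K : FiniteField) where
  open FF K

  commutativeRing : CommutativeRing 0ℓ 0ℓ
  commutativeRing = record { isCommutativeRing = isCommutativeRing }

  open CommutativeRing commutativeRing
    using (+-assoc; +-comm; +-identityʳ; -‿inverseʳ; distribˡ; distribʳ;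
           *-assoc; *-comm; *-identityˡ; *-identityʳ; zeroˡ; zeroʳ;
           ring; +-group; +-abelianGroup; *-commutativeSemigroup)
  open import Algebra.Properties.Ring ring using (+-identityʳ-unique; -1*x≈-x; -‿distribˡ-*; -‿distribʳ-*; x[y-z]≈xy-xz)
  open import Algebra.Properties.Group +-group using (//-rightDividesˡ; //-rightDividesʳ; ⁻¹-involutive; inverseˡ-unique; x∙y⁻¹≈ε⇒x≈y; ε⁻¹≈ε)
  open import Algebra.Properties.AbelianGroup +-abelianGroup using (⁻¹-anti-homo‿-)
  open import Algebra.Properties.CommutativeSemigroup *-commutativeSemigroup using (interchange)
  open ≡-Reasoning

  1≢0 : 1# ≢ 0#
  1≢0 1≡0 = 0≢1 (sym 1≡0)

  -x≢0 : ∀ {x} → x ≢ 0# → - x ≢ 0#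
  -x≢0 {x} x≢0 -x≡0 = x≢0 (trans (sym (⁻¹-involutive x)) (trans (cong -_ -x≡0) ε⁻¹≈ε))

  x⁻¹*[x*y]≡y : ∀ {x} → x ≢ 0# → ∀ y → x ⁻¹ * (x * y) ≡ y
  x⁻¹*[x*y]≡y {x} x≢0 y = begin
    x ⁻¹ * (x * y)  ≡⟨ *-assoc (x ⁻¹) x y ⟨
    x ⁻¹ * x * y    ≡⟨ cong (_* y) (trans (*-comm (x ⁻¹) x) (inverseʳ x x≢0)) ⟩
    1# * y          ≡⟨ *-identityˡ y ⟩
    y               ∎

  x*[x⁻¹*y]≡y : ∀ {x} → x ≢ 0# → ∀ y → x * (x ⁻¹ * y) ≡ y
  x*[x⁻¹*y]≡y {x} x≢0 y = begin
    x * (x ⁻¹ * y)  ≡⟨ *-assoc x (x ⁻¹) y ⟨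
    x * x ⁻¹ * y    ≡⟨ cong (_* y) (inverseʳ x x≢0) ⟩
    1# * y          ≡⟨ *-identityˡ y ⟩
    y               ∎

  x*y≡0⇒x≡0∨y≡0 : ∀ x y → x * y ≡ 0# → x ≡ 0# ⊎ y ≡ 0#
  x*y≡0⇒x≡0∨y≡0 x y xy≡0 with x ≟ 0#
  ... | yes x≡0 = inj₁ x≡0
  ... | no  x≢0 = inj₂ (begin
    y               ≡⟨ x⁻¹*[x*y]≡y x≢0 y ⟨
    x ⁻¹ * (x * y)  ≡⟨ cong (x ⁻¹ *_) xy≡0 ⟩
    x ⁻¹ * 0#       ≡⟨ zeroʳ (x ⁻¹) ⟩
    0#              ∎)

  x*y≢0 : ∀ {x y} → x ≢ 0# → y ≢ 0# → x * y ≢ 0#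
  x*y≢0 x≢0 y≢0 xy≡0 with x*y≡0⇒x≡0∨y≡0 _ _ xy≡0
  ... | inj₁ x≡0 = x≢0 x≡0
  ... | inj₂ y≡0 = y≢0 y≡0

  x⁻¹≢0 : ∀ {x} → x ≢ 0# → x ⁻¹ ≢ 0#
  x⁻¹≢0 {x} x≢0 x⁻¹≡0 = 0≢1 (begin
    0#         ≡⟨ zeroʳ x ⟨
    x * 0#     ≡⟨ cong (x *_) x⁻¹≡0 ⟨
    x * x ⁻¹   ≡⟨ inverseʳ x x≢0 ⟩
    1#         ∎)

  c*y≡b⇒y≡b/c : ∀ {b c y} → c ≢ 0# → c * y ≡ b → y ≡ b / c
  c*y≡b⇒y≡b/c {b} {c} {y} c≢0 cy≡b = begin
    y               ≡⟨ x⁻¹*[x*y]≡y c≢0 y ⟨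
    c ⁻¹ * (c * y)  ≡⟨ cong (c ⁻¹ *_) cy≡b ⟩
    c ⁻¹ * b        ≡⟨ *-comm (c ⁻¹) b ⟩
    b / c           ∎

  y≡b/c⇒c*y≡b : ∀ {b c y} → c ≢ 0# → y ≡ b / c → c * y ≡ b
  y≡b/c⇒c*y≡b {b} {c} c≢0 refl = trans (cong (c *_) (*-comm b (c ⁻¹))) (x*[x⁻¹*y]≡y c≢0 b)

  x^n≢0 : ∀ {x} n → x ≢ 0# → x ^ n ≢ 0#
  x^n≢0 zero    _   = 1≢0
  x^n≢0 (suc n) x≢0 = x*y≢0 x≢0 (x^n≢0 n x≢0)

  [x*y]^n≡x^n*y^n : ∀ x y n → (x * y) ^ n ≡ x ^ n * y ^ n
  [x*y]^n≡x^n*y^n x y zero    = sym (*-identityˡ 1#)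
  [x*y]^n≡x^n*y^n x y (suc n) = trans (cong (x * y *_) ([x*y]^n≡x^n*y^n x y n)) (interchange x y (x ^ n) (y ^ n))

  [-x]^n≡[-1]^n*x^n : ∀ x n → (- x) ^ n ≡ (- 1#) ^ n * x ^ n
  [-x]^n≡[-1]^n*x^n x n = trans (cong (_^ n) (sym (-1*x≈-x x))) ([x*y]^n≡x^n*y^n (- 1#) x n)

  [-x]*[-x]≡x*x : ∀ x → (- x) * (- x) ≡ x * x
  [-x]*[-x]≡x*x x = begin
    - x * - x      ≡⟨ -‿distribˡ-* x (- x) ⟨
    - (x * - x)    ≡⟨ cong -_ (-‿distribʳ-* x x) ⟨
    - - (x * x)    ≡⟨ ⁻¹-involutive (x * x) ⟩
    x * x          ∎

  x*x≡y*y⇒x≡±y : ∀ {x y} → x * x ≡ y * y → x ≡ y ⊎ x ≡ - y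
  x*x≡y*y⇒x≡±y {x} {y} xx≡yy with x*y≡0⇒x≡0∨y≡0 (x + y) (x - y) [x+y][x-y]≡0
    where
    [x+y][x-y]≡0 : (x + y) * (x - y) ≡ 0#
    [x+y][x-y]≡0 = begin
      (x + y) * (x - y)                        ≡⟨ x[y-z]≈xy-xz (x + y) x y ⟩
      ((x + y) * x) - ((x + y) * y)            ≡⟨ cong₂ _-_ (distribʳ x x y) (distribʳ y x y) ⟩
      (x * x + y * x) - (x * y + y * y)        ≡⟨ cong₂ (λ s t → (s + t) - (x * y + y * y)) xx≡yy (*-comm y x) ⟩
      (y * y + x * y) - (x * y + y * y)        ≡⟨ cong (_- (x * y + y * y)) (+-comm (y * y) (x * y)) ⟩
      (x * y + y * y) - (x * y + y * y)        ≡⟨ -‿inverseʳ (x * y + y * y) ⟩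
      0#                                       ∎
  ... | inj₁ x+y≡0 = inj₂ (inverseˡ-unique x y x+y≡0)
  ... | inj₂ x-y≡0 = inj₁ (x∙y⁻¹≈ε⇒x≈y x y x-y≡0)

  elems-complete : ∀ x → x ∈ elems
  elems-complete x = subst (_∈ elems) (Inverse.strictlyInverseˡ enum x)
    (∈-map⁺ (Inverse.to enum) (∈-allFin (Inverse.from enum x)))

  elems-unique : Unique elems
  elems-unique = Uniqueₚ.map⁺ to-injective (Uniqueₚ.allFin⁺ size)
    where
    to-injective : ∀ {i j} → Inverse.to enum i ≡ Inverse.to enum j → i ≡ j
    to-injective {i} {j} eq = begin
      i                                       ≡⟨ Inverse.strictlyInverseʳ enum i ⟨
      Inverse.from enum (Inverse.to enum i)   ≡⟨ cong (Inverse.from enum) eq ⟩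
      Inverse.from enum (Inverse.to enum j)   ≡⟨ Inverse.strictlyInverseʳ enum j ⟩
      j                                       ∎

  length-elems : length elems ≡ size
  length-elems = trans (Listₚ.length-map (Inverse.to enum) (allFin size)) (Listₚ.length-tabulate (λ i → i))

  index : Carrier → ℕ
  index x = Fin.toℕ (Inverse.from enum x)

  index-injective : ∀ {x y} → index x ≡ index y → x ≡ y
  index-injective {x} {y} eq = begin
    x                                       ≡⟨ Inverse.strictlyInverseˡ enum x ⟨
    Inverse.to enum (Inverse.from enum x)   ≡⟨ cong (Inverse.to enum) (Finₚ.toℕ-injective eq) ⟩
    Inverse.to enum (Inverse.from enum y)   ≡⟨ Inverse.strictlyInverseˡ enum y ⟩
    y                                       ∎

  open Counting elems elems-unique elems-complete public

  square? : Decidable IsSquare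
  square? x = any? (λ y → (y * y) ≟ x) elems

  square-intro : ∀ {x} y → y * y ≡ x → IsSquare x
  square-intro {x} y yy≡x = Any.map (λ { refl → yy≡x }) (elems-complete y)

  square-root : ∀ {x} → IsSquare x → Σ Carrier λ y → y * y ≡ x
  square-root = Any.satisfied

  -- 0# on non-squares
  squareRoot : Carrier → Carrier
  squareRoot x with square? x
  ... | yes □x = proj₁ (square-root □x)
  ... | no _   = 0#

  squareRoot-square : ∀ {x} → IsSquare x → squareRoot x * squareRoot x ≡ x
  squareRoot-square {x} □x with square? x
  ... | yes □x′ = proj₂ (square-root □x′)
  ... | no ¬□x  = ⊥-elim (¬□x □x)

  square-* : ∀ {x y} → IsSquare x → IsSquare y → IsSquare (x * y)
  square-* □x □y with square-root □x | square-root □y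
  ... | s , refl | t , refl = square-intro (s * t) (interchange s t s t)

  square-*-cancelˡ : ∀ {x y} → x ≢ 0# → IsSquare x → IsSquare (x * y) → IsSquare y
  square-*-cancelˡ {x} {y} x≢0 □x □xy with square-root □x | square-root □xy
  ... | s , refl | t , tt≡ssy = square-intro (t / s) (begin
    (t / s) * (t / s)                     ≡⟨ interchange t (s ⁻¹) t (s ⁻¹) ⟩
    (t * t) * (s ⁻¹ * s ⁻¹)               ≡⟨ cong (_* (s ⁻¹ * s ⁻¹)) tt≡ssy ⟩
    (s * s * y) * (s ⁻¹ * s ⁻¹)           ≡⟨ cong (_* (s ⁻¹ * s ⁻¹)) (*-comm (s * s) y) ⟩
    (y * (s * s)) * (s ⁻¹ * s ⁻¹)         ≡⟨ *-assoc y (s * s) (s ⁻¹ * s ⁻¹) ⟩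
    y * ((s * s) * (s ⁻¹ * s ⁻¹))         ≡⟨ cong (y *_) (interchange s s (s ⁻¹) (s ⁻¹)) ⟩
    y * ((s * s ⁻¹) * (s * s ⁻¹))         ≡⟨ cong (λ e → y * (e * e)) (inverseʳ s s≢0) ⟩
    y * (1# * 1#)                         ≡⟨ cong (y *_) (*-identityˡ 1#) ⟩
    y * 1#                                ≡⟨ *-identityʳ y ⟩
    y                                     ∎)
    where
    s≢0 : s ≢ 0#
    s≢0 s≡0 = x≢0 (trans (cong (_* s) s≡0) (zeroˡ s))

  η-0 : η 0# ≡ + 0
  η-0 with 0# ≟ 0#
  ... | yes _   = refl
  ... | no 0≢0 = ⊥-elim (0≢0 refl)

  η-square : ∀ {x} → x ≢ 0# → IsSquare x → η x ≡ + 1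
  η-square {x} x≢0 □x with x ≟ 0#
  ... | yes x≡0 = ⊥-elim (x≢0 x≡0)
  ... | no _ with square? x
  ... | yes _  = refl
  ... | no ¬□x = ⊥-elim (¬□x □x)

  η-nonsquare : ∀ {x} → x ≢ 0# → ¬ IsSquare x → η x ≡ -[1+ 0 ]
  η-nonsquare {x} x≢0 ¬□x with x ≟ 0#
  ... | yes x≡0 = ⊥-elim (x≢0 x≡0)
  ... | no _ with square? x
  ... | yes □x = ⊥-elim (¬□x □x)
  ... | no _   = refl

  η-nonzero : ∀ {x} → x ≢ 0# → η x ≡ + 1 ⊎ η x ≡ -[1+ 0 ]
  η-nonzero {x} x≢0 with square? x
  ... | yes □x  = inj₁ (η-square x≢0 □x)
  ... | no  ¬□x = inj₂ (η-nonsquare x≢0 ¬□x)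

  scaling : ∀ {a} → a ≢ 0# → Carrier ↔ Carrier
  scaling {a} a≢0 = mk↔ₛ′ (a *_) (a ⁻¹ *_) (x*[x⁻¹*y]≡y a≢0) (x⁻¹*[x*y]≡y a≢0)

  shiftedScaling : ∀ {a} → a ≢ 0# → Carrier ↔ Carrier
  shiftedScaling {a} a≢0 = mk↔ₛ′ (λ z → a * (z + 1#)) (λ y → (a ⁻¹ * y) - 1#)
    (λ y → begin
      a * ((a ⁻¹ * y) - 1# + 1#)   ≡⟨ cong (a *_) (//-rightDividesˡ 1# (a ⁻¹ * y)) ⟩
      a * (a ⁻¹ * y)               ≡⟨ x*[x⁻¹*y]≡y a≢0 y ⟩
      y                            ∎)
    (λ z → begin
      (a ⁻¹ * (a * (z + 1#))) - 1# ≡⟨ cong (_- 1#) (x⁻¹*[x*y]≡y a≢0 (z + 1#)) ⟩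
      (z + 1#) - 1#                ≡⟨ //-rightDividesʳ 1# z ⟩
      z                            ∎)

  module Homogeneous (F : Carrier → Carrier) {a c : Carrier} (a≢0 : a ≢ 0#) (c≢0 : c ≢ 0#)
                     (F-homogeneous : ∀ z → F (a * z) ≡ c * F z) where

    private
      module Pairs = Counting (cartesianProduct elems elems)
        (Uniqueₚ.cartesianProduct⁺ elems-unique elems-unique)
        (λ (x , y) → ∈-cartesianProduct⁺ (elems-complete x) (elems-complete y))

      a*[z+1]≡a*z+a : ∀ z → a * (z + 1#) ≡ a * z + a
      a*[z+1]≡a*z+a z = trans (distribˡ a z 1#) (cong (_+_ (a * z)) (*-identityʳ a))

      a*[z+1]-a≡a*z : ∀ z → (a * (z + 1#)) - a ≡ a * z
      a*[z+1]-a≡a*z z = begin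
        (a * (z + 1#)) - a    ≡⟨ cong (_- a) (a*[z+1]≡a*z+a z) ⟩
        (a * z + a) - a       ≡⟨ //-rightDividesʳ a (a * z) ⟩
        a * z                 ∎

      F-difference : ∀ x y → F (a * x) - F (a * y) ≡ c * (F x - F y)
      F-difference x y = trans (cong₂ _-_ (F-homogeneous x) (F-homogeneous y)) (sym (x[y-z]≈xy-xz c (F x) (F y)))

      F-unshifted-difference : ∀ x y → F ((a * (x + 1#)) - a) - F ((a * (y + 1#)) - a) ≡ c * (F x - F y)
      F-unshifted-difference x y = trans (cong₂ (λ s t → F s - F t) (a*[z+1]-a≡a*z x) (a*[z+1]-a≡a*z y)) (F-difference x y)

    δ-homogeneous : ∀ b → δ F a b ≡ δ F 1# (b / c)
    δ-homogeneous b = count-↔ _ _ (scaling a≢0)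
      (λ {w} eq → c*y≡b⇒y≡b/c c≢0 (trans (sym (increment w)) eq))
      (λ {w} eq → trans (increment w) (y≡b/c⇒c*y≡b c≢0 eq))
      where
      increment : ∀ w → F (a * w + a) - F (a * w) ≡ c * (F (w + 1#) - F w)
      increment w = trans (cong (λ t → F t - F (a * w)) (sym (a*[z+1]≡a*z+a w))) (F-difference (w + 1#) w)

    δ-homogeneous-neg : ∀ b → δ F (- a) b ≡ δ F 1# (b / (- c))
    δ-homogeneous-neg b = count-↔ _ _ (shiftedScaling a≢0)
      (λ {w} eq → c*y≡b⇒y≡b/c (-x≢0 c≢0) (trans (sym (decrement w)) eq))
      (λ {w} eq → trans (decrement w) (y≡b/c⇒c*y≡b (-x≢0 c≢0) eq))
      where
      decrement : ∀ w → F ((a * (w + 1#)) - a) - F (a * (w + 1#)) ≡ (- c) * (F (w + 1#) - F w)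
      decrement w = begin
        F ((a * (w + 1#)) - a) - F (a * (w + 1#)) ≡⟨ cong (λ t → F t - F (a * (w + 1#))) (a*[z+1]-a≡a*z w) ⟩
        F (a * w) - F (a * (w + 1#))              ≡⟨ F-difference w (w + 1#) ⟩
        c * (F w - F (w + 1#))                    ≡⟨ cong (c *_) (⁻¹-anti-homo‿- (F (w + 1#)) (F w)) ⟨
        c * - (F (w + 1#) - F w)                  ≡⟨ -‿distribʳ-* c _ ⟨
        - (c * (F (w + 1#) - F w))                ≡⟨ -‿distribˡ-* c _ ⟩
        (- c) * (F (w + 1#) - F w)                ∎

    β-homogeneous : ∀ b → β F a b ≡ β F 1# (b / c)
    β-homogeneous b = Pairs.count-↔ _ _ (scaling a≢0 ×-↔ scaling a≢0)
      (λ {(x , y)} (eq , eq′) → c*y≡b⇒y≡b/c c≢0 (trans (sym (F-difference x y)) eq)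
                              , c*y≡b⇒y≡b/c c≢0 (trans (sym (shifted x y)) eq′))
      (λ {(x , y)} (eq , eq′) → trans (F-difference x y) (y≡b/c⇒c*y≡b c≢0 eq)
                              , trans (shifted x y) (y≡b/c⇒c*y≡b c≢0 eq′))
      where
      shifted : ∀ x y → F (a * x + a) - F (a * y + a) ≡ c * (F (x + 1#) - F (y + 1#))
      shifted x y = trans (cong₂ (λ s t → F s - F t) (sym (a*[z+1]≡a*z+a x)) (sym (a*[z+1]≡a*z+a y)))
                          (F-difference (x + 1#) (y + 1#))

    β-homogeneous-neg : ∀ b → β F (- a) b ≡ β F 1# (b / c)
    β-homogeneous-neg b = Pairs.count-↔ _ _ (shiftedScaling a≢0 ×-↔ shiftedScaling a≢0)
      (λ {(x , y)} (eq , eq′) → c*y≡b⇒y≡b/c c≢0 (trans (sym (F-unshifted-difference x y)) eq′)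
                              , c*y≡b⇒y≡b/c c≢0 (trans (sym (F-difference (x + 1#) (y + 1#))) eq))
      (λ {(x , y)} (eq , eq′) → trans (F-difference (x + 1#) (y + 1#)) (y≡b/c⇒c*y≡b c≢0 eq′)
                              , trans (F-unshifted-difference x y) (y≡b/c⇒c*y≡b c≢0 eq))

  nonzero? : Decidable (_≢ 0#)
  nonzero? x = ¬? (x ≟ 0#)

  nonzeroSquare? : Decidable (λ x → x ≢ 0# × IsSquare x)
  nonzeroSquare? = nonzero? ∩? square?

  nonzeroNonsquare? : Decidable (λ x → x ≢ 0# × ¬ IsSquare x)
  nonzeroNonsquare? = nonzero? ∩? ∁? square?

  ∈-nonzero⁺ : ∀ {x} → x ≢ 0# → x ∈ nonzero
  ∈-nonzero⁺ {x} = ∈-filter⁺ nonzero? (elems-complete x)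

  ∈-nonzero⁻ : ∀ {x} → x ∈ nonzero → x ≢ 0#
  ∈-nonzero⁻ x∈ = proj₂ (∈-filter⁻ nonzero? {xs = elems} x∈)

  size≡1+count-nonzero : size ≡ suc (count nonzero?)
  size≡1+count-nonzero = begin
    size                                 ≡⟨ length-elems ⟨
    length elems                         ≡⟨ count-∁ (_≟ 0#) ⟩
    count (_≟ 0#) ℕ.+ count nonzero?     ≡⟨ cong (ℕ._+ count nonzero?) (count-singleton _≟_ 0#) ⟩
    suc (count nonzero?)                 ∎

  odd-size⇒1+1≢0 : size % 2 ≡ 1 → 1# + 1# ≢ 0#
  odd-size⇒1+1≢0 size-odd 1+1≡0 = case trans (sym size-odd) size%2≡0 of λ ()
    where
    [x+1]+1≡x : ∀ x → x + 1# + 1# ≡ x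
    [x+1]+1≡x x = trans (+-assoc x 1# 1#) (trans (cong (_+_ x) 1+1≡0) (+-identityʳ x))
    x+1≢x : ∀ {x} → x + 1# ≢ x
    x+1≢x {x} x+1≡x = 1≢0 (+-identityʳ-unique x 1# x+1≡x)
    k : ℕ
    k = count ((λ _ → yes tt) ∩? (λ x → index x <? index (x + 1#)))
    size≡k+k : size ≡ k ℕ.+ k
    size≡k+k = begin
      size                               ≡⟨ length-elems ⟨
      length elems                       ≡⟨ count-⊤ ⟨
      count {λ _ → ⊤} (λ _ → yes tt)     ≡⟨ count-involution (λ _ → yes tt) index index-injective (_+ 1#) [x+1]+1≡x (λ _ → tt) (λ _ → x+1≢x) ⟩
      k ℕ.+ k                            ∎
    k+k≡k*2 : k ℕ.+ k ≡ k ℕ.* 2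
    k+k≡k*2 = trans (cong (k ℕ.+_) (sym (ℕₚ.+-identityʳ k))) (ℕₚ.*-comm 2 k)
    size%2≡0 : size % 2 ≡ 0
    size%2≡0 = trans (cong (_% 2) (trans size≡k+k k+k≡k*2)) (DivMod.m*n%n≡0 k 2)

  module OddCharacteristic (1+1≢0 : 1# + 1# ≢ 0#) where

    -x≢x : ∀ {x} → x ≢ 0# → - x ≢ x
    -x≢x {x} x≢0 -x≡x with x*y≡0⇒x≡0∨y≡0 (1# + 1#) x [1+1]*x≡0
      where
      [1+1]*x≡0 : (1# + 1#) * x ≡ 0#
      [1+1]*x≡0 = begin
        (1# + 1#) * x     ≡⟨ distribʳ x 1# 1# ⟩
        1# * x + 1# * x   ≡⟨ cong₂ _+_ (*-identityˡ x) (trans (*-identityˡ x) (sym -x≡x)) ⟩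
        x - x             ≡⟨ -‿inverseʳ x ⟩
        0#                ∎
    ... | inj₁ 1+1≡0 = 1+1≢0 1+1≡0
    ... | inj₂ x≡0   = x≢0 x≡0

    -- Of x and - x exactly one is positive: the one with the smaller enumeration index.
    positive? : Decidable (λ x → x ≢ 0# × index x < index (- x))
    positive? = nonzero? ∩? (λ x → index x <? index (- x))

    positiveOf : Carrier → Carrier
    positiveOf y with index y <? index (- y)
    ... | yes _ = y
    ... | no _  = - y

    positiveOf-square : ∀ y → positiveOf y * positiveOf y ≡ y * y
    positiveOf-square y with index y <? index (- y)
    ... | yes _ = refl
    ... | no _  = [-x]*[-x]≡x*x y

    positiveOf-positive : ∀ {y} → y ≢ 0# → positiveOf y ≢ 0# × index (positiveOf y) < index (- positiveOf y)
    positiveOf-positive {y} y≢0 with index y <? index (- y)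
    ... | yes y<-y = y≢0 , y<-y
    ... | no  y≮-y = -x≢0 y≢0 , subst (λ t → index (- y) < index t) (sym (⁻¹-involutive y))
                       (ℕₚ.≤∧≢⇒< (ℕₚ.≮⇒≥ y≮-y) (λ -y≡y → -x≢x y≢0 (index-injective -y≡y)))

    count-positive≡count-square : count positive? ≡ count nonzeroSquare?
    count-positive≡count-square = ℕₚ.≤-antisym
      (count-≤ positive? nonzeroSquare? (λ x → x * x)
        (λ {x} (x≢0 , _) → x*y≢0 x≢0 x≢0 , square-intro x refl) squaring-injective)
      (count-≤ nonzeroSquare? positive? (λ s → positiveOf (squareRoot s))
        (λ (s≢0 , □s) → positiveOf-positive (λ √s≡0 → s≢0 (begin
          _                               ≡⟨ squareRoot-square □s ⟨
          squareRoot _ * squareRoot _     ≡⟨ cong (_* squareRoot _) √s≡0 ⟩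
          0# * squareRoot _               ≡⟨ zeroˡ _ ⟩
          0#                              ∎)))
        (λ {s} {t} (_ , □s) (_ , □t) eq → begin
          s                                                              ≡⟨ squareRoot-square □s ⟨
          squareRoot s * squareRoot s                                    ≡⟨ positiveOf-square (squareRoot s) ⟨
          positiveOf (squareRoot s) * positiveOf (squareRoot s)          ≡⟨ cong (λ y → y * y) eq ⟩
          positiveOf (squareRoot t) * positiveOf (squareRoot t)          ≡⟨ positiveOf-square (squareRoot t) ⟩
          squareRoot t * squareRoot t                                    ≡⟨ squareRoot-square □t ⟩
          t                                                              ∎))
      where
      squaring-injective : ∀ {x y} → x ≢ 0# × index x < index (- x) → y ≢ 0# × index y < index (- y) →
                           x * x ≡ y * y → x ≡ y
      squaring-injective {x} {y} (_ , x<-x) (_ , y<-y) xx≡yy with x*x≡y*y⇒x≡±y xx≡yy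
      ... | inj₁ x≡y  = x≡y
      ... | inj₂ x≡-y = ⊥-elim (ℕₚ.<-asym
             (subst (λ t → index x < index t) (trans (cong -_ x≡-y) (⁻¹-involutive y)) x<-x)
             (subst (λ t → index y < index t) (sym x≡-y) y<-y))

    count-nonzero≡2*count-square : count nonzero? ≡ count nonzeroSquare? ℕ.+ count nonzeroSquare?
    count-nonzero≡2*count-square = begin
      count nonzero?                           ≡⟨ count-involution nonzero? index index-injective -_ ⁻¹-involutive -x≢0 -x≢x ⟩
      count positive? ℕ.+ count positive?      ≡⟨ cong₂ ℕ._+_ count-positive≡count-square count-positive≡count-square ⟩
      count nonzeroSquare? ℕ.+ count nonzeroSquare? ∎

    count-nonsquare≡count-square : count nonzeroNonsquare? ≡ count nonzeroSquare?
    count-nonsquare≡count-square = ℕₚ.+-cancelˡ-≡ (count nonzeroSquare?) _ _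
      (trans (sym (count-∩ nonzero? square?)) count-nonzero≡2*count-square)

    -- {z | x z is a nonzero square} = x⁻¹ · (nonzero squares) lies among the non-squares and is
    -- just as large, so it contains y.
    nonsquare*nonsquare : ∀ {x y} → x ≢ 0# → ¬ IsSquare x → y ≢ 0# → ¬ IsSquare y → IsSquare (x * y)
    nonsquare*nonsquare {x} {y} x≢0 ¬□x y≢0 ¬□y with square? (x * y)
    ... | yes □xy = □xy
    ... | no ¬□xy = ⊥-elim (ℕₚ.<-irrefl count-x*≡count-square
                      (subst (count x*-square? <_) count-nonsquare≡count-square
                        (count-< x*-square? nonzeroNonsquare? x*-square⇒nonsquare y (y≢0 , ¬□y) (¬□xy ∘ proj₂))))
      where
      x*-square? : Decidable (λ z → x * z ≢ 0# × IsSquare (x * z))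
      x*-square? z = nonzeroSquare? (x * z)
      x*-square⇒nonsquare : ∀ {z} → x * z ≢ 0# × IsSquare (x * z) → z ≢ 0# × ¬ IsSquare z
      x*-square⇒nonsquare {z} (xz≢0 , □xz) =
        z≢0 , λ □z → ¬□x (square-*-cancelˡ z≢0 □z (subst IsSquare (*-comm x z) □xz))
        where
        z≢0 : z ≢ 0#
        z≢0 z≡0 = xz≢0 (trans (cong (x *_) z≡0) (zeroʳ x))
      count-x*≡count-square : count x*-square? ≡ count nonzeroSquare?
      count-x*≡count-square = count-↔ x*-square? nonzeroSquare? (scaling (x⁻¹≢0 x≢0))
        (subst (λ w → w ≢ 0# × IsSquare w) (x*[x⁻¹*y]≡y x≢0 _))
        (subst (λ w → w ≢ 0# × IsSquare w) (sym (x*[x⁻¹*y]≡y x≢0 _)))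

    private
      η-*-via : ∀ {x y i j} → η (x * y) ≡ i ℤ.* j → η x ≡ i → η y ≡ j → η (x * y) ≡ η x ℤ.* η y
      η-*-via ηxy≡ij ηx≡i ηy≡j = trans ηxy≡ij (sym (cong₂ ℤ._*_ ηx≡i ηy≡j))

    η-* : ∀ x y → η (x * y) ≡ η x ℤ.* η y
    η-* x y = by-cases (x ≟ 0#) (y ≟ 0#) (square? x) (square? y)
      where
      by-cases : Dec (x ≡ 0#) → Dec (y ≡ 0#) → Dec (IsSquare x) → Dec (IsSquare y) → η (x * y) ≡ η x ℤ.* η y
      by-cases (yes x≡0) _ _ _ = begin
        η (x * y)        ≡⟨ cong η (trans (cong (_* y) x≡0) (zeroˡ y)) ⟩
        η 0#             ≡⟨ η-0 ⟩
        + 0              ≡⟨ ℤₚ.*-zeroˡ (η y) ⟨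
        + 0 ℤ.* η y      ≡⟨ cong (ℤ._* η y) (trans (cong η x≡0) η-0) ⟨
        η x ℤ.* η y      ∎
      by-cases (no _) (yes y≡0) _ _ = begin
        η (x * y)        ≡⟨ cong η (trans (cong (x *_) y≡0) (zeroʳ x)) ⟩
        η 0#             ≡⟨ η-0 ⟩
        + 0              ≡⟨ ℤₚ.*-zeroʳ (η x) ⟨
        η x ℤ.* + 0      ≡⟨ cong (η x ℤ.*_) (trans (cong η y≡0) η-0) ⟨
        η x ℤ.* η y      ∎
      by-cases (no x≢0) (no y≢0) (yes □x) (yes □y) =
        η-*-via (η-square (x*y≢0 x≢0 y≢0) (square-* □x □y)) (η-square x≢0 □x) (η-square y≢0 □y)
      by-cases (no x≢0) (no y≢0) (yes □x) (no ¬□y) =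
        η-*-via (η-nonsquare (x*y≢0 x≢0 y≢0) (¬□y ∘ square-*-cancelˡ x≢0 □x))
                (η-square x≢0 □x) (η-nonsquare y≢0 ¬□y)
      by-cases (no x≢0) (no y≢0) (no ¬□x) (yes □y) =
        η-*-via (η-nonsquare (x*y≢0 x≢0 y≢0) (¬□x ∘ square-*-cancelˡ y≢0 □y ∘ subst IsSquare (*-comm x y)))
                (η-nonsquare x≢0 ¬□x) (η-square y≢0 □y)
      by-cases (no x≢0) (no y≢0) (no ¬□x) (no ¬□y) =
        η-*-via (η-square (x*y≢0 x≢0 y≢0) (nonsquare*nonsquare x≢0 ¬□x y≢0 ¬□y))
                (η-nonsquare x≢0 ¬□x) (η-nonsquare y≢0 ¬□y)

    size≡3[4]⇒-1-nonsquare : size % 4 ≡ 3 → ¬ IsSquare (- 1#)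
    size≡3[4]⇒-1-nonsquare size≡3 □-1 with square-root □-1
    ... | i , ii≡-1 = case trans (sym size≡3) size%4≡1 of λ ()
      where
      -square : ∀ {s} → s ≢ 0# × IsSquare s → - s ≢ 0# × IsSquare (- s)
      -square {s} (s≢0 , □s) with square-root □s
      ... | t , refl = -x≢0 s≢0 , square-intro (i * t) (begin
        (i * t) * (i * t)   ≡⟨ interchange i t i t ⟩
        (i * i) * (t * t)   ≡⟨ cong (_* (t * t)) ii≡-1 ⟩
        - 1# * (t * t)      ≡⟨ -1*x≈-x (t * t) ⟩
        - (t * t)           ∎)
      k : ℕ
      k = count (nonzeroSquare? ∩? (λ x → index x <? index (- x)))
      count-square≡k+k : count nonzeroSquare? ≡ k ℕ.+ k
      count-square≡k+k = count-involution nonzeroSquare? index index-injective -_ ⁻¹-involutive -square (-x≢x ∘ proj₁)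
      [n+n]+[n+n]≡n*4 : ∀ n → (n ℕ.+ n) ℕ.+ (n ℕ.+ n) ≡ n ℕ.* 4
      [n+n]+[n+n]≡n*4 = solve-∀
      size%4≡1 : size % 4 ≡ 1
      size%4≡1 = begin
        size % 4                                                 ≡⟨ cong (_% 4) size≡1+count-nonzero ⟩
        suc (count nonzero?) % 4                                 ≡⟨ cong (λ n → suc n % 4) count-nonzero≡2*count-square ⟩
        suc (count nonzeroSquare? ℕ.+ count nonzeroSquare?) % 4  ≡⟨ cong (λ n → suc (n ℕ.+ n) % 4) count-square≡k+k ⟩
        suc ((k ℕ.+ k) ℕ.+ (k ℕ.+ k)) % 4                        ≡⟨ cong (λ n → suc n % 4) ([n+n]+[n+n]≡n*4 k) ⟩
        (1 ℕ.+ k ℕ.* 4) % 4                                      ≡⟨ DivMod.[m+kn]%n≡m%n 1 k 4 ⟩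
        1                                                        ∎

    Fru-homogeneous : ∀ r u {a} → η a ≡ + 1 → ∀ z → Fru r u (a * z) ≡ a ^ r * Fru r u z
    Fru-homogeneous r u {a} ηa≡1 z = begin
      (a * z) ^ r * (1# + u * ι (η (a * z)))       ≡⟨ cong₂ (λ s t → s * (1# + u * ι t)) ([x*y]^n≡x^n*y^n a z r) ηaz≡ηz ⟩
      a ^ r * z ^ r * (1# + u * ι (η z))           ≡⟨ *-assoc (a ^ r) (z ^ r) _ ⟩
      a ^ r * Fru r u z                            ∎
      where
      ηaz≡ηz : η (a * z) ≡ η z
      ηaz≡ηz = trans (η-* a z) (trans (cong (ℤ._* η z) ηa≡1) (ℤₚ.*-identityˡ (η z)))

    η[-x]≡1 : ∀ {x} → size % 4 ≡ 3 → η x ≡ -[1+ 0 ] → η (- x) ≡ + 1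
    η[-x]≡1 {x} size≡3 ηx≡-1 = begin
      η (- x)               ≡⟨ cong η (-1*x≈-x x) ⟨
      η (- 1# * x)          ≡⟨ η-* (- 1#) x ⟩
      η (- 1#) ℤ.* η x      ≡⟨ cong₂ ℤ._*_ (η-nonsquare (-x≢0 1≢0) (size≡3[4]⇒-1-nonsquare size≡3)) ηx≡-1 ⟩
      + 1                   ∎

  module Fru-reductions (size≡3 : size % 4 ≡ 3) (r : ℕ) (u : Carrier) where

    private
      size-odd : size % 2 ≡ 1
      size-odd = trans (sym (DivMod.m∣n⇒o%n%m≡o%m 2 4 size (divides 2 refl))) (cong (_% 2) size≡3)

    open OddCharacteristic (odd-size⇒1+1≢0 size-odd)

    F : Carrier → Carrier
    F = Fru r u

    δ-Fru-square : ∀ {a} → a ≢ 0# → ∀ b → η a ≡ + 1 → δ F a b ≡ δ F 1# (b / (a ^ r))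
    δ-Fru-square a≢0 b ηa≡1 = Homogeneous.δ-homogeneous F a≢0 (x^n≢0 r a≢0) (Fru-homogeneous r u ηa≡1) b

    δ-Fru-nonsquare : ∀ {a} → a ≢ 0# → ∀ b → η a ≡ -[1+ 0 ] →
                      δ F a b ≡ δ F 1# (b / (((- 1#) ^ suc r) * (a ^ r)))
    δ-Fru-nonsquare {a} a≢0 b ηa≡-1 = begin
      δ F a b                               ≡⟨ cong (λ t → δ F t b) (⁻¹-involutive a) ⟨
      δ F (- (- a)) b                       ≡⟨ Homogeneous.δ-homogeneous-neg F (-x≢0 a≢0) (x^n≢0 r (-x≢0 a≢0))
                                                 (Fru-homogeneous r u (η[-x]≡1 size≡3 ηa≡-1)) b ⟩
      δ F 1# (b / (- ((- a) ^ r)))          ≡⟨ cong (λ t → δ F 1# (b / t)) -[-a]^r≡[-1]^[1+r]*a^r ⟩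
      δ F 1# (b / (((- 1#) ^ suc r) * (a ^ r))) ∎
      where
      -[-a]^r≡[-1]^[1+r]*a^r : - ((- a) ^ r) ≡ (- 1#) ^ suc r * a ^ r
      -[-a]^r≡[-1]^[1+r]*a^r = begin
        - ((- a) ^ r)                     ≡⟨ cong -_ ([-x]^n≡[-1]^n*x^n a r) ⟩
        - ((- 1#) ^ r * a ^ r)            ≡⟨ -1*x≈-x _ ⟨
        - 1# * ((- 1#) ^ r * a ^ r)       ≡⟨ *-assoc (- 1#) _ _ ⟨
        (- 1#) ^ suc r * a ^ r            ∎

    β-Fru-square : ∀ {a} → a ≢ 0# → ∀ b → η a ≡ + 1 → β F a b ≡ β F 1# (b / (a ^ r))
    β-Fru-square a≢0 b ηa≡1 = Homogeneous.β-homogeneous F a≢0 (x^n≢0 r a≢0) (Fru-homogeneous r u ηa≡1) b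

    β-Fru-nonsquare : ∀ {a} → a ≢ 0# → ∀ b → η a ≡ -[1+ 0 ] →
                      β F a b ≡ β F 1# (b / (((- 1#) ^ r) * (a ^ r)))
    β-Fru-nonsquare {a} a≢0 b ηa≡-1 = begin
      β F a b                               ≡⟨ cong (λ t → β F t b) (⁻¹-involutive a) ⟨
      β F (- (- a)) b                       ≡⟨ Homogeneous.β-homogeneous-neg F (-x≢0 a≢0) (x^n≢0 r (-x≢0 a≢0))
                                                 (Fru-homogeneous r u (η[-x]≡1 size≡3 ηa≡-1)) b ⟩
      β F 1# (b / ((- a) ^ r))              ≡⟨ cong (λ t → β F 1# (b / t)) ([-x]^n≡[-1]^n*x^n a r) ⟩
      β F 1# (b / (((- 1#) ^ r) * (a ^ r))) ∎

    δmax-Fru : δmax F ≡ maxℕ (map (δ F 1#) elems)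
    δmax-Fru = foldr-⊔-concatMap-row (δ F) (∈-nonzero⁺ 1≢0) reduce
      where
      reduce : ∀ {a b} → a ∈ nonzero → b ∈ elems → ∃[ b′ ] b′ ∈ elems × δ F a b ≡ δ F 1# b′
      reduce {a} {b} a∈ _ with ∈-nonzero⁻ a∈ | η-nonzero (∈-nonzero⁻ a∈)
      ... | a≢0 | inj₁ ηa≡1  = _ , elems-complete _ , δ-Fru-square a≢0 b ηa≡1
      ... | a≢0 | inj₂ ηa≡-1 = _ , elems-complete _ , δ-Fru-nonsquare a≢0 b ηa≡-1

    βmax-Fru : βmax F ≡ maxℕ (map (β F 1#) nonzero)
    βmax-Fru = foldr-⊔-concatMap-row (β F) (∈-nonzero⁺ 1≢0) reduce
      where
      b/c∈nonzero : ∀ {b c} → b ∈ nonzero → c ≢ 0# → b / c ∈ nonzero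
      b/c∈nonzero b∈ c≢0 = ∈-nonzero⁺ (x*y≢0 (∈-nonzero⁻ b∈) (x⁻¹≢0 c≢0))
      reduce : ∀ {a b} → a ∈ nonzero → b ∈ nonzero → ∃[ b′ ] b′ ∈ nonzero × β F a b ≡ β F 1# b′
      reduce {a} {b} a∈ b∈ with ∈-nonzero⁻ a∈ | η-nonzero (∈-nonzero⁻ a∈)
      ... | a≢0 | inj₁ ηa≡1  = _ , b/c∈nonzero b∈ (x^n≢0 r a≢0) , β-Fru-square a≢0 b ηa≡1
      ... | a≢0 | inj₂ ηa≡-1 = _ , b/c∈nonzero b∈ (x*y≢0 (x^n≢0 r (-x≢0 1≢0)) (x^n≢0 r a≢0)) ,
                                 β-Fru-nonsquare a≢0 b ηa≡-1

lemma11 : (K : FiniteField) → let open FF K in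
  (∃₂ λ p k → Prime p × p % 2 ≡ 1 × size ≡ p ℕ.^ k) →
  size % 4 ≡ 3 →
  (r : ℕ) → 1 ≤ r → (u : Carrier) →
  ((a b : Carrier) → a ≢ 0# →
     (η a ≡ + 1 → δ (Fru r u) a b ≡ δ (Fru r u) 1# (b / (a ^ r)))
   × (η a ≡ -[1+ 0 ] → δ (Fru r u) a b ≡ δ (Fru r u) 1# (b / (((- 1#) ^ (ℕ.suc r)) * (a ^ r))))
   × (η a ≡ + 1 → β (Fru r u) a b ≡ β (Fru r u) 1# (b / (a ^ r)))
   × (η a ≡ -[1+ 0 ] → β (Fru r u) a b ≡ β (Fru r u) 1# (b / (((- 1#) ^ r) * (a ^ r)))))
  × δmax (Fru r u) ≡ maxℕ (map (δ (Fru r u) 1#) elems)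
  × βmax (Fru r u) ≡ maxℕ (map (β (Fru r u) 1#) nonzero)
lemma11 K _ size≡3 r _ u =
    (λ a b a≢0 → δ-Fru-square a≢0 b , δ-Fru-nonsquare a≢0 b , β-Fru-square a≢0 b , β-Fru-nonsquare a≢0 b)
  , δmax-Fru
  , βmax-Fru
  where open Field.Fru-reductions K size≡3 r u
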